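{- Let $m,l,n,k$ be positive integers with $m\geq n$ and $ml=nk$, and let $G=G(X,Y,E)$ be a bipartite graph with bipartition $(X,Y)$ such that $|X|=m$, $|Y|=n$, every vertex of $X$ has degree $l$ and every vertex of $Y$ has degree $k$ (i.e. $G\in Bip(m,l,n,k)$). Then $w_Y(G)=k$ and $w_X(G)\leq l\cdot\left\lceil\frac{m}{l}\right\rceil$.
   Context: All graphs are finite, undirected, without loops or multiple edges. An interval is a nonempty set of consecutive integers; $[p,q]$ denotes the interval with minimum $p$ and maximum $q$. A proper edge $t$-coloring of a graph $G$ is a function $\varphi:E(G)\to[1,t]$ such that every color in $[1,t]$ is used and no two adjacent edges receive the same color. For a vertex $x$, its spectrum under $\varphi$ is $S_G(x,\varphi)=\{\varphi(e): e\in E(G),\ e \text{ incident with } x\}$. A proper edge coloring $\varphi$ is interval in $x$ if $S_G(x,\varphi)$ is an interval, and interval on a set $R\subseteq V(G)$ if it is interval in every $x\in R$. A subset $R\subseteq V(G)$ has the $i$-property if some proper edge $t$-coloring of $G$ (for some $t$) is interval on $R$; for such $R$, $w_R(G)$ denotes the minimum $t$ such that there exists a proper edge $t$-coloring of $G$ interval on $R$. -}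

module Defs where

open import Data.Nat using (ℕ; _+_; _*_; _∸_; _≤_; NonZero)
open import Data.Nat.DivMod using (_/_)
open import Data.Bool using (Bool; T)
open import Data.Fin using (Fin)
open import Data.List using (length; filterᵇ; allFin)
open import Data.Product using (Σ; ∃; _×_)
open import Function.Bundles using (_⇔_)
open import Relation.Binary.PropositionalEquality using (_≡_; _≢_)

-- A bipartite graph G(X,Y,E) with X = Fin m, Y = Fin n, given by its
-- (bipartite) adjacency relation: adj x y = true iff xy ∈ E.
-- Simple graph: no loops, no multiple edges, all edges between X and Y.
BipGraph : ℕ → ℕ → Set
BipGraph m n = Fin m → Fin n → Bool

Edge : ∀ {m n} → BipGraph m n → Fin m → Fin n → Set
Edge G x y = T (G x y)

degX : ∀ {m n} → BipGraph m n → Fin m → ℕ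
degX {m} {n} G x = length (filterᵇ (λ y → G x y) (allFin n))

degY : ∀ {m n} → BipGraph m n → Fin n → ℕ
degY {m} {n} G y = length (filterᵇ (λ x → G x y) (allFin m))

InBip : (m l n k : ℕ) → BipGraph m n → Set
InBip m l n k G = (∀ x → degX G x ≡ l) × (∀ y → degY G y ≡ k)

-- An edge colouring assigns a colour to each pair (x , y); only the values
-- on edges (pairs with Edge G x y) matter.
Colouring : ℕ → ℕ → Set
Colouring m n = Fin m → Fin n → ℕ

IsProperEdgeColouring : ∀ {m n} → BipGraph m n → ℕ → Colouring m n → Set
IsProperEdgeColouring {m} {n} G t φ =
  (∀ x y → Edge G x y → 1 ≤ φ x y × φ x y ≤ t)
  × (∀ c → 1 ≤ c → c ≤ t → ∃ λ x → ∃ λ y → Edge G x y × φ x y ≡ c)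
  × (∀ x y y′ → Edge G x y → Edge G x y′ → y ≢ y′ → φ x y ≢ φ x y′)
  × (∀ x x′ y → Edge G x y → Edge G x′ y → x ≢ x′ → φ x y ≢ φ x′ y)

IsInterval : (ℕ → Set) → Set
IsInterval S = ∃ λ p → ∃ λ q → p ≤ q × (∀ c → S c ⇔ (p ≤ c × c ≤ q))

SpecX : ∀ {m n} → BipGraph m n → Colouring m n → Fin m → ℕ → Set
SpecX G φ x c = ∃ λ y → Edge G x y × φ x y ≡ c

SpecY : ∀ {m n} → BipGraph m n → Colouring m n → Fin n → ℕ → Set
SpecY G φ y c = ∃ λ x → Edge G x y × φ x y ≡ c

IntervalOnX : ∀ {m n} → BipGraph m n → Colouring m n → Set
IntervalOnX {m} G φ = (x : Fin m) → IsInterval (SpecX G φ x)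

IntervalOnY : ∀ {m n} → BipGraph m n → Colouring m n → Set
IntervalOnY {m} {n} G φ = (y : Fin n) → IsInterval (SpecY G φ y)

HasIntColX : ∀ {m n} → BipGraph m n → ℕ → Set
HasIntColX {m} {n} G t = Σ (Colouring m n) λ φ → IsProperEdgeColouring G t φ × IntervalOnX G φ

HasIntColY : ∀ {m n} → BipGraph m n → ℕ → Set
HasIntColY {m} {n} G t = Σ (Colouring m n) λ φ → IsProperEdgeColouring G t φ × IntervalOnY G φ

wY≡ : ∀ {m n} → BipGraph m n → ℕ → Set
wY≡ G w = HasIntColY G w × (∀ t → HasIntColY G t → w ≤ t)

wX≤ : ∀ {m n} → BipGraph m n → ℕ → Set
wX≤ G b = ∃ λ t → t ≤ b × HasIntColX G t

⌈_/_⌉ : (a b : ℕ) → .{{NonZero b}} → ℕ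
⌈ a / b ⌉ = (a + b ∸ 1) / b

module Submission where

-- Both halves rest on König's edge colouring theorem: a bipartite graph of
-- maximum degree at most Δ has a proper edge colouring with colours from
-- [1,Δ].  It is proved by adding the edges one at a time; when the colours
-- missing at the two ends of a new edge differ, a Kempe swap along an
-- alternating two-coloured chain makes them agree.  A counting argument (a
-- pigeonhole principle for distinct colours from [1,Δ]) shows that at a
-- vertex of degree Δ all colours of [1,Δ] occur.
--
-- Half one: m ≥ n forces l ≤ k, so a König k-colouring of G has spectrum
-- [1,k] at every vertex of Y, and no proper colouring needs fewer than k
-- colours.  Half two: cut X into blocks of l consecutive vertices, give each
-- vertex of Y one copy per block, colour the resulting graph of maximum
-- degree l by König, and shift the colours at x by l times the block of x.

open import Defs
open import Data.Bool using (Bool; true; false; T)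
open import Data.Bool.Properties using (T?)
open import Data.Empty using (⊥-elim)
open import Data.Fin using (Fin; zero; suc; toℕ; fromℕ<; combine; remQuot)
open import Data.Fin.Properties using (any?; toℕ-injective; toℕ<n; toℕ-fromℕ<; suc-injective; 0≢1+n; combine-remQuot; remQuot-combine; combine-injective) renaming (_≟_ to _≟F_)
open import Data.List using (length; filterᵇ; allFin; tabulate)
open import Data.Nat using (ℕ; zero; suc; _+_; _*_; _∸_; _≤_; _<_; _≥_; z≤n; s≤s; NonZero; >-nonZero⁻¹; _≟_)
open import Data.Nat.DivMod using (_/_; _%_; _mod_; m≡m%n+[m/n]*n; m%n<n; m≤n⇒m%n≡m; m*n/n≡m; n/n≡1; m/n≤m; m/n*n≤m; m<n⇒m/n≡0; m<n*o⇒m/o<n; /-monoˡ-≤; +-distrib-/-∣ˡ; +-distrib-/-∣ʳ)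
open import Data.Nat.Divisibility using (n∣m*n; ∣-refl)
open import Data.Nat.Properties using (≤-refl; ≤-trans; ≤-reflexive; ≤-antisym; ≤-pred; <-irrefl; <-≤-trans; ≤-<-trans; n≮0; n<1+n; m<n⇒n≢0; m≤m+n; m≤n+m; +-comm; +-suc; +-identityʳ; +-cancelˡ-≡; +-mono-≤; +-monoʳ-≤; +-mono-<-≤; +-mono-≤-<; *-comm; *-monoˡ-≤; *-cancelˡ-≤; m+n∸m≡n; m+[n∸m]≡n; ∸-monoˡ-≤; module ≤-Reasoning) renaming (suc-injective to suc-injectiveℕ)
open import Data.Product using (Σ; ∃; _×_; _,_; proj₁; proj₂)
open import Data.Sum using (_⊎_; inj₁; inj₂; map₂)
open import Function using (_∘_; id)
open import Function.Bundles using (_⇔_; mk⇔; Equivalence)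
open import Relation.Binary.PropositionalEquality using (_≡_; _≢_; refl; sym; trans; cong; cong₂; subst; module ≡-Reasoning)
open import Relation.Nullary using (¬_; Dec; yes; no)
open import Relation.Nullary.Decidable using (_×-dec_; ¬?)

count : ∀ {a} → (Fin a → Bool) → ℕ
count {zero}  p = 0
count {suc a} p with p zero
... | true  = suc (count (p ∘ suc))
... | false = count (p ∘ suc)

length-filter-tabulate : ∀ {A : Set} {a} (p : A → Bool) (f : Fin a → A) →
  length (filterᵇ p (tabulate f)) ≡ count (p ∘ f)
length-filter-tabulate {a = zero}  p f = refl
length-filter-tabulate {a = suc a} p f with p (f zero)
... | true  = cong suc (length-filter-tabulate p (f ∘ suc))
... | false = length-filter-tabulate p (f ∘ suc)

length-filter≡count : ∀ {a} (p : Fin a → Bool) → length (filterᵇ p (allFin a)) ≡ count p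
length-filter≡count p = length-filter-tabulate p id

remove : ∀ {b} → (Fin b → Bool) → Fin b → Fin b → Bool
remove q zero    zero    = false
remove q zero    (suc j) = q (suc j)
remove q (suc i) zero    = q zero
remove q (suc i) (suc j) = remove (q ∘ suc) i j

remove-other : ∀ {b} (q : Fin b → Bool) i j → j ≢ i → remove q i j ≡ q j
remove-other q zero    zero    j≢i = ⊥-elim (j≢i refl)
remove-other q zero    (suc j) j≢i = refl
remove-other q (suc i) zero    j≢i = refl
remove-other q (suc i) (suc j) j≢i = remove-other (q ∘ suc) i j (j≢i ∘ cong suc)

count-remove : ∀ {b} (q : Fin b → Bool) i → T (q i) → count q ≡ suc (count (remove q i))
count-remove q zero    qi with q zero
... | true = refl
count-remove q (suc i) qi with q zero
... | true  = cong suc (count-remove (q ∘ suc) i qi)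
... | false = count-remove (q ∘ suc) i qi

count-injection : ∀ {a b} (p : Fin a → Bool) (q : Fin b → Bool) (f : Fin a → Fin b) →
  (∀ i → T (p i) → T (q (f i))) →
  (∀ i j → T (p i) → T (p j) → f i ≡ f j → i ≡ j) → count p ≤ count q
count-injection {zero}  p q f maps inj = z≤n
count-injection {suc a} p q f maps inj with p zero in p0
... | false = count-injection (p ∘ suc) q (f ∘ suc) (maps ∘ suc)
                (λ i j pi pj → suc-injective ∘ inj (suc i) (suc j) pi pj)
... | true  = subst (suc (count (p ∘ suc)) ≤_) (sym (count-remove q (f zero) (maps zero p0T)))
                (s≤s (count-injection (p ∘ suc) (remove q (f zero)) (f ∘ suc) maps′
                       (λ i j pi pj → suc-injective ∘ inj (suc i) (suc j) pi pj)))
  where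
  p0T : T (p zero)
  p0T = subst T (sym p0) _
  maps′ : ∀ i → T (p (suc i)) → T (remove q (f zero) (f (suc i)))
  maps′ i pi = subst T (sym (remove-other q (f zero) (f (suc i)) (0≢1+n ∘ sym ∘ inj (suc i) zero pi p0T)))
                 (maps (suc i) pi)

count-all : ∀ a → count {a} (λ _ → true) ≡ a
count-all zero    = refl
count-all (suc a) = cong suc (count-all a)

count-mono : ∀ {a} (p q : Fin a → Bool) → (∀ i → T (p i) → T (q i)) → count p ≤ count q
count-mono p q p⊆q = count-injection p q id p⊆q (λ _ _ _ _ e → e)

count-strict : ∀ {a} (p q : Fin a → Bool) → (∀ i → T (p i) → T (q i)) →
  (i : Fin a) → T (q i) → ¬ T (p i) → count p < count q
count-strict p q p⊆q i qi ¬pi = subst (suc (count p) ≤_) (sym (count-remove q i qi))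
  (s≤s (count-mono p (remove q i) λ j pj →
     subst T (sym (remove-other q i j (λ { refl → ¬pi pj }))) (p⊆q j pj)))

-- The palette of colours 1..Δ, seen as the nonzero elements of Fin (suc Δ).
isColour : ∀ {Δ} → Fin (suc Δ) → Bool
isColour zero    = false
isColour (suc _) = true

module DistinctColours {a} (p : Fin a → Bool) (v : Fin a → ℕ) (Δ : ℕ)
  (inRange : ∀ i → T (p i) → 1 ≤ v i × v i ≤ Δ)
  (distinct : ∀ i j → T (p i) → T (p j) → i ≢ j → v i ≢ v j) where

  code : ℕ → Fin (suc Δ)
  code c = c mod suc Δ

  toℕ-code : ∀ {c} → c ≤ Δ → toℕ (code c) ≡ c
  toℕ-code c≤Δ = trans (toℕ-fromℕ< _) (m≤n⇒m%n≡m c≤Δ)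

  code-isColour : ∀ {c} → 1 ≤ c → c ≤ Δ → T (isColour (code c))
  code-isColour {c} 1≤c c≤Δ with code c | toℕ-code c≤Δ
  ... | suc _ | _  = _
  ... | zero  | eq = ⊥-elim (m<n⇒n≢0 1≤c (sym eq))

  code-injective : ∀ {c d} → c ≤ Δ → d ≤ Δ → code c ≡ code d → c ≡ d
  code-injective c≤Δ d≤Δ e = trans (sym (toℕ-code c≤Δ)) (trans (cong toℕ e) (toℕ-code d≤Δ))

  colour : Fin a → Fin (suc Δ)
  colour i = code (v i)

  colour-isColour : ∀ i → T (p i) → T (isColour (colour i))
  colour-isColour i pi = code-isColour (proj₁ (inRange i pi)) (proj₂ (inRange i pi))

  colour-injective : ∀ i j → T (p i) → T (p j) → colour i ≡ colour j → i ≡ j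
  colour-injective i j pi pj e with i ≟F j
  ... | yes i≡j = i≡j
  ... | no  i≢j = ⊥-elim (distinct i j pi pj i≢j
                    (code-injective (proj₂ (inRange i pi)) (proj₂ (inRange j pj)) e))

  count≤Δ : count p ≤ Δ
  count≤Δ = subst (count p ≤_) (count-all Δ)
    (count-injection p isColour colour colour-isColour colour-injective)

  absent⇒count<Δ : ∀ c → 1 ≤ c → c ≤ Δ → (∀ i → T (p i) → v i ≢ c) → count p < Δ
  absent⇒count<Δ c 1≤c c≤Δ absent =
    subst (suc (count p) ≤_) (trans (sym (count-remove isColour (code c) (code-isColour 1≤c c≤Δ))) (count-all Δ))
      (s≤s (count-injection p (remove isColour (code c)) colour avoids-c colour-injective))
    where
    avoids-c : ∀ i → T (p i) → T (remove isColour (code c) (colour i))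
    avoids-c i pi = subst T (sym (remove-other isColour (code c) (colour i)
                      (absent i pi ∘ code-injective (proj₂ (inRange i pi)) c≤Δ)))
                      (colour-isColour i pi)

  occurs? : ∀ c → Dec (∃ λ i → T (p i) × v i ≡ c)
  occurs? c = any? (λ i → T? (p i) ×-dec (v i ≟ c))

  count≥Δ⇒all-occur : Δ ≤ count p → ∀ c → 1 ≤ c → c ≤ Δ → ∃ λ i → T (p i) × v i ≡ c
  count≥Δ⇒all-occur Δ≤count c 1≤c c≤Δ with occurs? c
  ... | yes found = found
  ... | no  none  = ⊥-elim (<-irrefl refl (≤-<-trans Δ≤count
                      (absent⇒count<Δ c 1≤c c≤Δ (λ i pi e → none (i , pi , e)))))

  -- If every colour occurred, choosing an occurrence of each would inject
  -- [1,Δ] into the selected entries.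
  count<Δ⇒some-absent : count p < Δ → ∃ λ c → 1 ≤ c × c ≤ Δ × (∀ i → T (p i) → v i ≢ c)
  count<Δ⇒some-absent count<Δ with any? {n = Δ} (λ j → ¬? (occurs? (suc (toℕ j))))
  ... | yes (j , absent) = suc (toℕ j) , s≤s z≤n , toℕ<n j , λ i pi e → absent (i , pi , e)
  ... | no  ¬absent      = ⊥-elim (<-irrefl refl (≤-<-trans Δ≤count count<Δ))
    where
    witness : ∀ (j : Fin Δ) → ∃ λ i → T (p i) × v i ≡ suc (toℕ j)
    witness j with occurs? (suc (toℕ j))
    ... | yes found = found
    ... | no  none  = ⊥-elim (¬absent (j , none))
    witness-injective : ∀ j j′ → proj₁ (witness j) ≡ proj₁ (witness j′) → j ≡ j′
    witness-injective j j′ e = toℕ-injective (suc-injectiveℕ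
      (trans (sym (proj₂ (proj₂ (witness j)))) (trans (cong v e) (proj₂ (proj₂ (witness j′))))))
    Δ≤count : Δ ≤ count p
    Δ≤count = subst (_≤ count p) (count-all Δ)
      (count-injection (λ _ → true) p (proj₁ ∘ witness) (λ j _ → proj₁ (proj₂ (witness j)))
        (λ j j′ _ _ → witness-injective j j′))

-- Matrices with rows indexed by X = Fin m and columns by Y = Fin n; a
-- Boolean matrix is a bipartite graph, a natural one a partial colouring.
Matrix : Set → ℕ → ℕ → Set
Matrix A m n = Fin m → Fin n → A

-- Changing a single entry.  Kept abstract: only the three lemmas below are
-- ever needed about it.
abstract
  update : ∀ {A : Set} {m n} → Matrix A m n → Fin m → Fin n → A → Matrix A m n
  update M x₀ y₀ a x y with x ≟F x₀ | y ≟F y₀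
  ... | yes _ | yes _ = a
  ... | _     | _     = M x y

  update-hit : ∀ {A : Set} {m n} (M : Matrix A m n) x₀ y₀ a → update M x₀ y₀ a x₀ y₀ ≡ a
  update-hit M x₀ y₀ a with x₀ ≟F x₀ | y₀ ≟F y₀
  ... | yes _ | yes _   = refl
  ... | yes _ | no  y≢y = ⊥-elim (y≢y refl)
  ... | no x≢x | _      = ⊥-elim (x≢x refl)

  update-row : ∀ {A : Set} {m n} (M : Matrix A m n) x₀ y₀ a x y → x ≢ x₀ → update M x₀ y₀ a x y ≡ M x y
  update-row M x₀ y₀ a x y x≢x₀ with x ≟F x₀ | y ≟F y₀
  ... | yes x≡x₀ | _ = ⊥-elim (x≢x₀ x≡x₀)
  ... | no _     | _ = refl

  update-col : ∀ {A : Set} {m n} (M : Matrix A m n) x₀ y₀ a x y → y ≢ y₀ → update M x₀ y₀ a x y ≡ M x y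
  update-col M x₀ y₀ a x y y≢y₀ with x ≟F x₀ | y ≟F y₀
  ... | yes _ | yes y≡y₀ = ⊥-elim (y≢y₀ y≡y₀)
  ... | yes _ | no _     = refl
  ... | no _  | _        = refl

update-cases : ∀ {A : Set} {m n} (M : Matrix A m n) x₀ y₀ a x y →
  (x ≡ x₀ × y ≡ y₀) ⊎ (update M x₀ y₀ a x y ≡ M x y)
update-cases M x₀ y₀ a x y with x ≟F x₀ | y ≟F y₀
... | yes x≡x₀ | yes y≡y₀ = inj₁ (x≡x₀ , y≡y₀)
... | yes _    | no y≢y₀  = inj₂ (update-col M x₀ y₀ a x y y≢y₀)
... | no x≢x₀  | _        = inj₂ (update-row M x₀ y₀ a x y x≢x₀)

count₂ : ∀ {m n} → Matrix Bool m n → ℕ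
count₂ {zero}  H = 0
count₂ {suc m} H = count (H zero) + count₂ (H ∘ suc)

count₂-mono : ∀ {m n} (H K : Matrix Bool m n) → (∀ x y → T (H x y) → T (K x y)) → count₂ H ≤ count₂ K
count₂-mono {zero}  H K H⊆K = z≤n
count₂-mono {suc m} H K H⊆K =
  +-mono-≤ (count-mono (H zero) (K zero) (H⊆K zero)) (count₂-mono (H ∘ suc) (K ∘ suc) (H⊆K ∘ suc))

count₂-strict : ∀ {m n} (H K : Matrix Bool m n) → (∀ x y → T (H x y) → T (K x y)) →
  ∀ x y → T (K x y) → ¬ T (H x y) → count₂ H < count₂ K
count₂-strict {suc m} H K H⊆K zero y Kxy ¬Hxy =
  +-mono-<-≤ (count-strict (H zero) (K zero) (H⊆K zero) y Kxy ¬Hxy) (count₂-mono (H ∘ suc) (K ∘ suc) (H⊆K ∘ suc))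
count₂-strict {suc m} H K H⊆K (suc x) y Kxy ¬Hxy =
  +-mono-≤-< (count-mono (H zero) (K zero) (H⊆K zero)) (count₂-strict (H ∘ suc) (K ∘ suc) (H⊆K ∘ suc) x y Kxy ¬Hxy)

count₂-switch-off : ∀ {m n} (H K : Matrix Bool m n) x₀ y₀ → T (H x₀ y₀) → ¬ T (K x₀ y₀) →
  (∀ x y → (x ≡ x₀ × y ≡ y₀) ⊎ (K x y ≡ H x y)) → count₂ K < count₂ H
count₂-switch-off H K x₀ y₀ Hx₀y₀ ¬Kx₀y₀ agree = count₂-strict K H K⊆H x₀ y₀ Hx₀y₀ ¬Kx₀y₀
  where
  K⊆H : ∀ x y → T (K x y) → T (H x y)
  K⊆H x y Kxy with agree x y
  ... | inj₁ (refl , refl) = ⊥-elim (¬Kx₀y₀ Kxy)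
  ... | inj₂ e             = subst T e Kxy

-- A partial proper Δ-colouring: colour 0 means "uncoloured", colours are at
-- most Δ, and no nonzero colour is repeated in a row or in a column.
record IsPartialColouring {m n} (Δ : ℕ) (C : Matrix ℕ m n) : Set where
  field
    bounded      : ∀ x y → C x y ≤ Δ
    row-distinct : ∀ x y y′ → y ≢ y′ → C x y ≡ C x y′ → C x y ≡ 0
    col-distinct : ∀ x x′ y → x ≢ x′ → C x y ≡ C x′ y → C x y ≡ 0

recolour-proper : ∀ {m n Δ} (C : Matrix ℕ m n) x₀ y₀ c → IsPartialColouring Δ C → c ≤ Δ →
  (∀ y → y ≢ y₀ → C x₀ y ≡ c → c ≡ 0) →
  (∀ x → x ≢ x₀ → C x y₀ ≡ c → c ≡ 0) → IsPartialColouring Δ (update C x₀ y₀ c)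
recolour-proper {m} {n} {Δ} C x₀ y₀ c proper c≤Δ row-free col-free = record
  { bounded = bounded′ ; row-distinct = row-distinct′ ; col-distinct = col-distinct′ }
  where
  open IsPartialColouring proper
  C′ : Matrix ℕ m n
  C′ = update C x₀ y₀ c
  bounded′ : ∀ x y → C′ x y ≤ Δ
  bounded′ x y with update-cases C x₀ y₀ c x y
  ... | inj₁ (refl , refl) = subst (_≤ Δ) (sym (update-hit C x₀ y₀ c)) c≤Δ
  ... | inj₂ e             = subst (_≤ Δ) (sym e) (bounded x y)
  -- A clash involving the new entry is excluded by freeness of c; any other
  -- clash already existed in C.
  row-distinct′ : ∀ x y y′ → y ≢ y′ → C′ x y ≡ C′ x y′ → C′ x y ≡ 0
  row-distinct′ x y y′ y≢y′ e with x ≟F x₀ | y ≟F y₀ | y′ ≟F y₀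
  ... | no x≢x₀ | _ | _ rewrite update-row C x₀ y₀ c x y x≢x₀ | update-row C x₀ y₀ c x y′ x≢x₀ =
    row-distinct x y y′ y≢y′ e
  ... | yes refl | yes refl | yes refl = ⊥-elim (y≢y′ refl)
  ... | yes refl | yes refl | no y′≢y₀ rewrite update-hit C x₀ y₀ c | update-col C x₀ y₀ c x₀ y′ y′≢y₀ =
    row-free y′ y′≢y₀ (sym e)
  ... | yes refl | no y≢y₀ | yes refl rewrite update-hit C x₀ y₀ c | update-col C x₀ y₀ c x₀ y y≢y₀ =
    trans e (row-free y y≢y₀ e)
  ... | yes refl | no y≢y₀ | no y′≢y₀ rewrite update-col C x₀ y₀ c x₀ y y≢y₀ | update-col C x₀ y₀ c x₀ y′ y′≢y₀ =
    row-distinct x₀ y y′ y≢y′ e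
  col-distinct′ : ∀ x x′ y → x ≢ x′ → C′ x y ≡ C′ x′ y → C′ x y ≡ 0
  col-distinct′ x x′ y x≢x′ e with y ≟F y₀ | x ≟F x₀ | x′ ≟F x₀
  ... | no y≢y₀ | _ | _ rewrite update-col C x₀ y₀ c x y y≢y₀ | update-col C x₀ y₀ c x′ y y≢y₀ =
    col-distinct x x′ y x≢x′ e
  ... | yes refl | yes refl | yes refl = ⊥-elim (x≢x′ refl)
  ... | yes refl | yes refl | no x′≢x₀ rewrite update-hit C x₀ y₀ c | update-row C x₀ y₀ c x′ y₀ x′≢x₀ =
    col-free x′ x′≢x₀ (sym e)
  ... | yes refl | no x≢x₀ | yes refl rewrite update-hit C x₀ y₀ c | update-row C x₀ y₀ c x y₀ x≢x₀ =
    trans e (col-free x x≢x₀ e)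
  ... | yes refl | no x≢x₀ | no x′≢x₀ rewrite update-row C x₀ y₀ c x y₀ x≢x₀ | update-row C x₀ y₀ c x′ y₀ x′≢x₀ =
    col-distinct x x′ y₀ x≢x′ e

module KempeSwap {m n : ℕ} (Δ α β : ℕ) (α≢β : α ≢ β) (1≤α : 1 ≤ α) (1≤β : 1 ≤ β)
                 (α≤Δ : α ≤ Δ) (β≤Δ : β ≤ Δ) where

  isαβ : ℕ → Bool
  isαβ c with c ≟ α | c ≟ β
  ... | yes _ | _     = true
  ... | no _  | yes _ = true
  ... | no _  | no _  = false

  isαβ-α : T (isαβ α)
  isαβ-α with α ≟ α
  ... | yes _   = _
  ... | no α≢α = ⊥-elim (α≢α refl)

  isαβ-β : T (isαβ β)
  isαβ-β with β ≟ α | β ≟ β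
  ... | yes _ | _      = _
  ... | no _  | yes _  = _
  ... | no _  | no β≢β = ⊥-elim (β≢β refl)

  isαβ-cases : ∀ c → T (isαβ c) → c ≡ α ⊎ c ≡ β
  isαβ-cases c αβ with c ≟ α | c ≟ β
  ... | yes c≡α | _     = inj₁ c≡α
  ... | no _    | yes c≡β = inj₂ c≡β

  isαβ⇒nonzero : ∀ c → T (isαβ c) → 1 ≤ c
  isαβ⇒nonzero c αβ with isαβ-cases c αβ
  ... | inj₁ refl = 1≤α
  ... | inj₂ refl = 1≤β

  ¬isαβ-0 : ¬ T (isαβ 0)
  ¬isαβ-0 αβ = m<n⇒n≢0 (isαβ⇒nonzero 0 αβ) refl

  αβ-edges : Matrix ℕ m n → Matrix Bool m n
  αβ-edges C x y = isαβ (C x y)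

  -- The outcome of swapping α and β along the α/β-chain that leaves column
  -- y through its α-edge: α becomes absent at y, only α/β-edges change (and
  -- stay α/β-edges), and rows without α and other columns without β are
  -- untouched.
  record Swap (C : Matrix ℕ m n) (y : Fin n) : Set where
    field
      C′                  : Matrix ℕ m n
      proper              : IsPartialColouring Δ C′
      α-absent            : ∀ x → C′ x y ≢ α
      others-kept         : ∀ x y′ → ¬ T (isαβ (C x y′)) → C′ x y′ ≡ C x y′
      αβ-kept             : ∀ x y′ → T (isαβ (C x y′)) → T (isαβ (C′ x y′))
      rows-without-α-kept : ∀ x → (∀ y′ → C x y′ ≢ α) → ∀ y′ → C′ x y′ ≡ C x y′
      cols-without-β-kept : ∀ y′ → y′ ≢ y → (∀ x → C x y′ ≢ β) → ∀ x → C′ x y′ ≡ C x y′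

    αβ-reflected : ∀ x y′ → T (isαβ (C′ x y′)) → T (isαβ (C x y′))
    αβ-reflected x y′ αβ′ with T? (isαβ (C x y′))
    ... | yes αβ = αβ
    ... | no ¬αβ = subst (T ∘ isαβ) (others-kept x y′ ¬αβ) αβ′

  swap-trivial : ∀ C → IsPartialColouring Δ C → ∀ y → (∀ x → C x y ≢ α) → Swap C y
  swap-trivial C proper y α-absent = record
    { C′ = C ; proper = proper ; α-absent = α-absent ; others-kept = λ _ _ _ → refl
    ; αβ-kept = λ _ _ αβ → αβ ; rows-without-α-kept = λ _ _ _ → refl
    ; cols-without-β-kept = λ _ _ _ _ → refl }

  -- The chain is the single edge x₁y coloured α, and β is absent at x₁:
  -- recolour that edge β.
  swap-single : ∀ C → IsPartialColouring Δ C → ∀ y → (∀ x → C x y ≢ β) →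
    ∀ x₁ → C x₁ y ≡ α → (∀ y′ → C x₁ y′ ≢ β) → Swap C y
  swap-single C proper y β-absent x₁ C[x₁,y]≡α β-absent-x₁ = record
    { C′ = update C x₁ y β
    ; proper = recolour-proper C x₁ y β proper β≤Δ (λ y′ _ e → ⊥-elim (β-absent-x₁ y′ e))
                 (λ x _ e → ⊥-elim (β-absent x e))
    ; α-absent = α-absent
    ; others-kept = others-kept
    ; αβ-kept = αβ-kept
    ; rows-without-α-kept = λ x no-α y′ → update-row C x₁ y β x y′ (λ { refl → no-α y C[x₁,y]≡α })
    ; cols-without-β-kept = λ y′ y′≢y _ x → update-col C x₁ y β x y′ y′≢y }
    where
    open IsPartialColouring proper
    α-absent : ∀ x → update C x₁ y β x y ≢ α
    α-absent x e with x ≟F x₁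
    ... | yes refl = α≢β (sym (trans (sym (update-hit C x₁ y β)) e))
    ... | no x≢x₁  = m<n⇒n≢0 1≤α (trans (sym e′) (col-distinct x x₁ y x≢x₁ (trans e′ (sym C[x₁,y]≡α))))
      where e′ : C x y ≡ α
            e′ = trans (sym (update-row C x₁ y β x y x≢x₁)) e
    others-kept : ∀ x y′ → ¬ T (isαβ (C x y′)) → update C x₁ y β x y′ ≡ C x y′
    others-kept x y′ ¬αβ with update-cases C x₁ y β x y′
    ... | inj₁ (refl , refl) = ⊥-elim (¬αβ (subst (T ∘ isαβ) (sym C[x₁,y]≡α) isαβ-α))
    ... | inj₂ e             = e
    αβ-kept : ∀ x y′ → T (isαβ (C x y′)) → T (isαβ (update C x₁ y β x y′))
    αβ-kept x y′ αβ with update-cases C x₁ y β x y′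
    ... | inj₁ (refl , refl) = subst (T ∘ isαβ) (sym (update-hit C x₁ y β)) isαβ-β
    ... | inj₂ e             = subst (T ∘ isαβ) (sym e) αβ

  -- The chain continues: x₁y is coloured α and x₁y₁ is coloured β.  Uncolour
  -- x₁y₁ to get D, in which β is absent at y₁ and there are fewer
  -- α/β-edges; swap the rest of the chain in D from y₁ (giving D′), then
  -- colour x₁y with β and x₁y₁ with α.
  module Extend (C : Matrix ℕ m n) (C-proper : IsPartialColouring Δ C) (y : Fin n)
                (β-absent : ∀ x → C x y ≢ β) (x₁ : Fin m) (C[x₁,y]≡α : C x₁ y ≡ α)
                (y₁ : Fin n) (C[x₁,y₁]≡β : C x₁ y₁ ≡ β) where

    open IsPartialColouring C-proper

    y≢y₁ : y ≢ y₁
    y≢y₁ refl = α≢β (trans (sym C[x₁,y]≡α) C[x₁,y₁]≡β)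

    D : Matrix ℕ m n
    D = update C x₁ y₁ 0

    D-proper : IsPartialColouring Δ D
    D-proper = recolour-proper C x₁ y₁ 0 C-proper z≤n (λ _ _ _ → refl) (λ _ _ _ → refl)

    D-β-absent : ∀ x → D x y₁ ≢ β
    D-β-absent x e with x ≟F x₁
    ... | yes refl = m<n⇒n≢0 1≤β (trans (sym e) (update-hit C x₁ y₁ 0))
    ... | no x≢x₁  = m<n⇒n≢0 1≤β (trans (sym e′) (col-distinct x x₁ y₁ x≢x₁ (trans e′ (sym C[x₁,y₁]≡β))))
      where e′ : C x y₁ ≡ β
            e′ = trans (sym (update-row C x₁ y₁ 0 x y₁ x≢x₁)) e

    D-smaller : count₂ (αβ-edges D) < count₂ (αβ-edges C)
    D-smaller = count₂-switch-off (αβ-edges C) (αβ-edges D) x₁ y₁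
      (subst (T ∘ isαβ) (sym C[x₁,y₁]≡β) isαβ-β)
      (subst (λ c → ¬ T (isαβ c)) (sym (update-hit C x₁ y₁ 0)) ¬isαβ-0)
      (λ x y′ → map₂ (cong isαβ) (update-cases C x₁ y₁ 0 x y′))

    -- Column y is the same in C and D, and stays so in D′ since β is absent
    -- from it.
    D-col-y : ∀ x → D x y ≡ C x y
    D-col-y x = update-col C x₁ y₁ 0 x y y≢y₁

    module _ (R : Swap D y₁) where

      open Swap R renaming (C′ to D′; proper to D′-proper; α-absent to D′-α-absent)

      D′-col-y : ∀ x → D′ x y ≡ C x y
      D′-col-y x = trans (cols-without-β-kept y y≢y₁ (λ x e → β-absent x (trans (sym (D-col-y x)) e)) x) (D-col-y x)

      D′-row-x₁ : ∀ y′ → y′ ≢ y → ¬ T (isαβ (D′ x₁ y′))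
      D′-row-x₁ y′ y′≢y αβ′ with αβ-reflected x₁ y′ αβ′ | y′ ≟F y₁
      ... | αβ | yes refl = ¬isαβ-0 (subst (T ∘ isαβ) (update-hit C x₁ y₁ 0) αβ)
      ... | αβ | no y′≢y₁ with isαβ-cases (C x₁ y′) (subst (T ∘ isαβ) (update-col C x₁ y₁ 0 x₁ y′ y′≢y₁) αβ)
      ... | inj₁ e = m<n⇒n≢0 1≤α (trans (sym e) (row-distinct x₁ y′ y y′≢y (trans e (sym C[x₁,y]≡α))))
      ... | inj₂ e = m<n⇒n≢0 1≤β (trans (sym e) (row-distinct x₁ y′ y₁ y′≢y₁ (trans e (sym C[x₁,y₁]≡β))))

      -- Colouring x₁y with β is proper: β is absent from column y, and
      -- from row x₁ of D′.
      E : Matrix ℕ m n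
      E = update D′ x₁ y β

      E-proper : IsPartialColouring Δ E
      E-proper = recolour-proper D′ x₁ y β D′-proper β≤Δ
        (λ y′ y′≢y e → ⊥-elim (D′-row-x₁ y′ y′≢y (subst (T ∘ isαβ) (sym e) isαβ-β)))
        (λ x _ e → ⊥-elim (β-absent x (trans (sym (D′-col-y x)) e)))

      -- Colouring x₁y₁ with α is proper: α has left row x₁ of E, and the
      -- swap in D removed it from column y₁.
      C′ : Matrix ℕ m n
      C′ = update E x₁ y₁ α

      C′-proper : IsPartialColouring Δ C′
      C′-proper = recolour-proper E x₁ y₁ α E-proper α≤Δ α-free-row α-free-col
        where
        α-free-row : ∀ y′ → y′ ≢ y₁ → E x₁ y′ ≡ α → α ≡ 0
        α-free-row y′ _ e with y′ ≟F y
        ... | yes refl  = ⊥-elim (α≢β (trans (sym e) (update-hit D′ x₁ y β)))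
        ... | no y′≢y = ⊥-elim (D′-row-x₁ y′ y′≢y
                          (subst (T ∘ isαβ) (sym (trans (sym (update-col D′ x₁ y β x₁ y′ y′≢y)) e)) isαβ-α))
        α-free-col : ∀ x → x ≢ x₁ → E x y₁ ≡ α → α ≡ 0
        α-free-col x _ e = ⊥-elim (D′-α-absent x (trans (sym (update-col D′ x₁ y β x y₁ (y≢y₁ ∘ sym))) e))

      -- The only α-edge at y was x₁y, which now has colour β.
      C′-α-absent : ∀ x → C′ x y ≢ α
      C′-α-absent x e with x ≟F x₁
      ... | yes refl = α≢β (sym (trans (sym (update-hit D′ x₁ y β)) (trans (sym (update-col E x₁ y₁ α x₁ y y≢y₁)) e)))
      ... | no x≢x₁  = m<n⇒n≢0 1≤α (trans (sym e′) (col-distinct x x₁ y x≢x₁ (trans e′ (sym C[x₁,y]≡α))))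
        where e′ : C x y ≡ α
              e′ = trans (sym (trans (update-col E x₁ y₁ α x y y≢y₁) (trans (update-row D′ x₁ y β x y x≢x₁) (D′-col-y x)))) e

      -- The remaining invariants pass from D′ through the three changed
      -- entries x₁y₁ (β, 0, α) and x₁y (α, β), which are all α/β-edges.
      C′-others-kept : ∀ x y′ → ¬ T (isαβ (C x y′)) → C′ x y′ ≡ C x y′
      C′-others-kept x y′ ¬αβ with update-cases E x₁ y₁ α x y′
      ... | inj₁ (refl , refl) = ⊥-elim (¬αβ (subst (T ∘ isαβ) (sym C[x₁,y₁]≡β) isαβ-β))
      ... | inj₂ e₁ with update-cases D′ x₁ y β x y′
      ... | inj₁ (refl , refl) = ⊥-elim (¬αβ (subst (T ∘ isαβ) (sym C[x₁,y]≡α) isαβ-α))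
      ... | inj₂ e₂ with update-cases C x₁ y₁ 0 x y′
      ... | inj₁ (refl , refl) = ⊥-elim (¬αβ (subst (T ∘ isαβ) (sym C[x₁,y₁]≡β) isαβ-β))
      ... | inj₂ e₃ = trans e₁ (trans e₂ (trans (others-kept x y′ (subst (λ c → ¬ T (isαβ c)) (sym e₃) ¬αβ)) e₃))

      C′-αβ-kept : ∀ x y′ → T (isαβ (C x y′)) → T (isαβ (C′ x y′))
      C′-αβ-kept x y′ αβ with update-cases E x₁ y₁ α x y′
      ... | inj₁ (refl , refl) = subst (T ∘ isαβ) (sym (update-hit E x₁ y₁ α)) isαβ-α
      ... | inj₂ e₁ with update-cases D′ x₁ y β x y′
      ... | inj₁ (refl , refl) = subst (T ∘ isαβ) (sym (trans e₁ (update-hit D′ x₁ y β))) isαβ-β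
      ... | inj₂ e₂ with update-cases C x₁ y₁ 0 x y′
      ... | inj₁ (refl , refl) = subst (T ∘ isαβ) (sym (update-hit E x₁ y₁ α)) isαβ-α
      ... | inj₂ e₃ = subst (T ∘ isαβ) (sym (trans e₁ e₂)) (αβ-kept x y′ (subst (T ∘ isαβ) (sym e₃) αβ))

      C′-rows-kept : ∀ x → (∀ y′ → C x y′ ≢ α) → ∀ y′ → C′ x y′ ≡ C x y′
      C′-rows-kept x no-α y′ =
        trans (update-row E x₁ y₁ α x y′ x≢x₁) (trans (update-row D′ x₁ y β x y′ x≢x₁)
          (trans (rows-without-α-kept x (λ y″ e → no-α y″ (trans (sym (update-row C x₁ y₁ 0 x y″ x≢x₁)) e)) y′)
                 (update-row C x₁ y₁ 0 x y′ x≢x₁)))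
        where x≢x₁ : x ≢ x₁
              x≢x₁ refl = no-α y C[x₁,y]≡α

      C′-cols-kept : ∀ y′ → y′ ≢ y → (∀ x → C x y′ ≢ β) → ∀ x → C′ x y′ ≡ C x y′
      C′-cols-kept y′ y′≢y no-β x =
        trans (update-col E x₁ y₁ α x y′ y′≢y₁) (trans (update-col D′ x₁ y β x y′ y′≢y)
          (trans (cols-without-β-kept y′ y′≢y₁ (λ x″ e → no-β x″ (trans (sym (update-col C x₁ y₁ 0 x″ y′ y′≢y₁)) e)) x)
                 (update-col C x₁ y₁ 0 x y′ y′≢y₁)))
        where y′≢y₁ : y′ ≢ y₁
              y′≢y₁ refl = no-β x₁ C[x₁,y₁]≡β

      extend : Swap C y
      extend = record
        { C′ = C′ ; proper = C′-proper ; α-absent = C′-α-absent ; others-kept = C′-others-kept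
        ; αβ-kept = C′-αβ-kept ; rows-without-α-kept = C′-rows-kept ; cols-without-β-kept = C′-cols-kept }

  -- Kempe's lemma: if β is absent at column y, α can be made absent there
  -- by swapping along a chain.  Induction on the number of α/β-edges.
  swap-bounded : ∀ N C → count₂ (αβ-edges C) ≤ N → IsPartialColouring Δ C →
    ∀ y → (∀ x → C x y ≢ β) → Swap C y
  swap-bounded N C bound proper y β-absent with any? (λ x → C x y ≟ α)
  ... | no no-α = swap-trivial C proper y (λ x e → no-α (x , e))
  ... | yes (x₁ , C[x₁,y]≡α) with any? (λ y₁ → C x₁ y₁ ≟ β)
  ... | no no-β = swap-single C proper y β-absent x₁ C[x₁,y]≡α (λ y₁ e → no-β (y₁ , e))
  ... | yes (y₁ , C[x₁,y₁]≡β) with N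
  ... | zero  = ⊥-elim (n≮0 (<-≤-trans D-smaller bound))
    where open Extend C proper y β-absent x₁ C[x₁,y]≡α y₁ C[x₁,y₁]≡β
  ... | suc N = extend (swap-bounded N D (≤-pred (<-≤-trans D-smaller bound)) D-proper y₁ D-β-absent)
    where open Extend C proper y β-absent x₁ C[x₁,y]≡α y₁ C[x₁,y₁]≡β

  swap : ∀ C → IsPartialColouring Δ C → ∀ y → (∀ x → C x y ≢ β) → Swap C y
  swap C = swap-bounded (count₂ (αβ-edges C)) C ≤-refl

ColoursEdges : ∀ {m n} → Matrix Bool m n → Matrix ℕ m n → Set
ColoursEdges H C = ∀ x y → (T (H x y) → 1 ≤ C x y) × (¬ T (H x y) → C x y ≡ 0)

EdgeColouring : ∀ {m n} → ℕ → Matrix Bool m n → Set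
EdgeColouring {m} {n} Δ H = Σ (Matrix ℕ m n) λ C → IsPartialColouring Δ C × ColoursEdges H C

row : ∀ {A : Set} {m n} → Matrix A m n → Fin m → Fin n → A
row H x = H x

col : ∀ {A : Set} {m n} → Matrix A m n → Fin n → Fin m → A
col H y x = H x y

module _ {m n : ℕ} {Δ : ℕ} (H : Matrix Bool m n) (C : Matrix ℕ m n)
         (proper : IsPartialColouring Δ C) (colours : ColoursEdges H C) where

  open IsPartialColouring proper

  module RowColours (x : Fin m) = DistinctColours (row H x) (row C x) Δ
    (λ y e → proj₁ (colours x y) e , bounded x y)
    (λ y y′ e _ y≢y′ same → m<n⇒n≢0 (proj₁ (colours x y) e) (row-distinct x y y′ y≢y′ same))

  module ColColours (y : Fin n) = DistinctColours (col H y) (col C y) Δ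
    (λ x e → proj₁ (colours x y) e , bounded x y)
    (λ x x′ e _ x≢x′ same → m<n⇒n≢0 (proj₁ (colours x y) e) (col-distinct x x′ y x≢x′ same))

  absent-at-row : ∀ x → count (row H x) < Δ → ∃ λ c → 1 ≤ c × c ≤ Δ × (∀ y → C x y ≢ c)
  absent-at-row x deg<Δ with RowColours.count<Δ⇒some-absent x deg<Δ
  ... | c , 1≤c , c≤Δ , absent = c , 1≤c , c≤Δ , absent′
    where absent′ : ∀ y → C x y ≢ c
          absent′ y e with T? (H x y)
          ... | yes edge = absent y edge e
          ... | no ¬edge = m<n⇒n≢0 1≤c (trans (sym e) (proj₂ (colours x y) ¬edge))

  absent-at-col : ∀ y → count (col H y) < Δ → ∃ λ c → 1 ≤ c × c ≤ Δ × (∀ x → C x y ≢ c)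
  absent-at-col y deg<Δ with ColColours.count<Δ⇒some-absent y deg<Δ
  ... | c , 1≤c , c≤Δ , absent = c , 1≤c , c≤Δ , absent′
    where absent′ : ∀ x → C x y ≢ c
          absent′ x e with T? (H x y)
          ... | yes edge = absent x edge e
          ... | no ¬edge = m<n⇒n≢0 1≤c (trans (sym e) (proj₂ (colours x y) ¬edge))

_∖_,_ : ∀ {m n} → Matrix Bool m n → Fin m → Fin n → Matrix Bool m n
H ∖ x₀ , y₀ = update H x₀ y₀ false

deleted-absent : ∀ {m n} (H : Matrix Bool m n) x₀ y₀ → ¬ T ((H ∖ x₀ , y₀) x₀ y₀)
deleted-absent H x₀ y₀ = subst (λ b → ¬ T b) (sym (update-hit H x₀ y₀ false)) (λ ())

deleted-⊆ : ∀ {m n} (H : Matrix Bool m n) x₀ y₀ x y → T ((H ∖ x₀ , y₀) x y) → T (H x y)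
deleted-⊆ H x₀ y₀ x y e with update-cases H x₀ y₀ false x y
... | inj₁ (refl , refl) = ⊥-elim (deleted-absent H x₀ y₀ e)
... | inj₂ same          = subst T same e

deleted-fewer-edges : ∀ {m n} (H : Matrix Bool m n) x₀ y₀ → T (H x₀ y₀) → count₂ (H ∖ x₀ , y₀) < count₂ H
deleted-fewer-edges H x₀ y₀ edge =
  count₂-switch-off H (H ∖ x₀ , y₀) x₀ y₀ edge (deleted-absent H x₀ y₀) (update-cases H x₀ y₀ false)

deleted-row-degree : ∀ {m n} (H : Matrix Bool m n) x₀ y₀ x → count (row (H ∖ x₀ , y₀) x) ≤ count (row H x)
deleted-row-degree H x₀ y₀ x = count-mono (row (H ∖ x₀ , y₀) x) (row H x) (deleted-⊆ H x₀ y₀ x)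

deleted-col-degree : ∀ {m n} (H : Matrix Bool m n) x₀ y₀ y → count (col (H ∖ x₀ , y₀) y) ≤ count (col H y)
deleted-col-degree H x₀ y₀ y = count-mono (col (H ∖ x₀ , y₀) y) (col H y) (λ x → deleted-⊆ H x₀ y₀ x y)

deleted-row-degree-x₀ : ∀ {m n} (H : Matrix Bool m n) x₀ y₀ → T (H x₀ y₀) →
  count (row (H ∖ x₀ , y₀) x₀) < count (row H x₀)
deleted-row-degree-x₀ H x₀ y₀ edge =
  count-strict (row (H ∖ x₀ , y₀) x₀) (row H x₀) (deleted-⊆ H x₀ y₀ x₀) y₀ edge (deleted-absent H x₀ y₀)

deleted-col-degree-y₀ : ∀ {m n} (H : Matrix Bool m n) x₀ y₀ → T (H x₀ y₀) →
  count (col (H ∖ x₀ , y₀) y₀) < count (col H y₀)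
deleted-col-degree-y₀ H x₀ y₀ edge =
  count-strict (col (H ∖ x₀ , y₀) y₀) (col H y₀) (λ x → deleted-⊆ H x₀ y₀ x y₀) x₀ edge (deleted-absent H x₀ y₀)

colour-deleted-edge : ∀ {m n Δ} (H : Matrix Bool m n) (C : Matrix ℕ m n) → IsPartialColouring Δ C →
  ∀ x₀ y₀ → T (H x₀ y₀) → ColoursEdges (H ∖ x₀ , y₀) C →
  ∀ α → 1 ≤ α → α ≤ Δ → (∀ y → C x₀ y ≢ α) → (∀ x → C x y₀ ≢ α) → EdgeColouring Δ H
colour-deleted-edge H C proper x₀ y₀ edge colours α 1≤α α≤Δ α-absent-x₀ α-absent-y₀ =
  update C x₀ y₀ α ,
  recolour-proper C x₀ y₀ α proper α≤Δ (λ y _ e → ⊥-elim (α-absent-x₀ y e)) (λ x _ e → ⊥-elim (α-absent-y₀ x e)) ,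
  colours′
  where
  kept : ∀ x y → update C x₀ y₀ α x y ≡ C x y → (H ∖ x₀ , y₀) x y ≡ H x y →
         (T (H x y) → 1 ≤ update C x₀ y₀ α x y) × (¬ T (H x y) → update C x₀ y₀ α x y ≡ 0)
  kept x y C-same H-same =
    (λ e → subst (1 ≤_) (sym C-same) (proj₁ (colours x y) (subst T (sym H-same) e))) ,
    (λ ¬e → trans C-same (proj₂ (colours x y) (subst (λ b → ¬ T b) (sym H-same) ¬e)))
  colours′ : ColoursEdges H (update C x₀ y₀ α)
  colours′ x y with x ≟F x₀ | y ≟F y₀
  ... | yes refl | yes refl = (λ _ → subst (1 ≤_) (sym (update-hit C x₀ y₀ α)) 1≤α) , (λ ¬edge → ⊥-elim (¬edge edge))
  ... | yes refl | no y≢y₀  = kept x₀ y (update-col C x₀ y₀ α x₀ y y≢y₀) (update-col H x₀ y₀ false x₀ y y≢y₀)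
  ... | no x≢x₀  | _        = kept x y (update-row C x₀ y₀ α x y x≢x₀) (update-row H x₀ y₀ false x y x≢x₀)

-- Let α be absent at x₀ and β at y₀; if α ≠ β, swapping the
-- α/β-chain through y₀ makes α absent at y₀ while keeping it absent at x₀.
add-edge : ∀ {m n Δ} (H : Matrix Bool m n) x₀ y₀ → T (H x₀ y₀) →
  count (row (H ∖ x₀ , y₀) x₀) < Δ → count (col (H ∖ x₀ , y₀) y₀) < Δ →
  EdgeColouring Δ (H ∖ x₀ , y₀) → EdgeColouring Δ H
add-edge {Δ = Δ} H x₀ y₀ edge deg-x₀ deg-y₀ (C , proper , colours)
  with absent-at-row (H ∖ x₀ , y₀) C proper colours x₀ deg-x₀
     | absent-at-col (H ∖ x₀ , y₀) C proper colours y₀ deg-y₀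
... | α , 1≤α , α≤Δ , α-absent-x₀ | β , 1≤β , β≤Δ , β-absent-y₀ with α ≟ β
... | yes refl = colour-deleted-edge H C proper x₀ y₀ edge colours α 1≤α α≤Δ α-absent-x₀ β-absent-y₀
... | no α≢β   = colour-deleted-edge H C′ proper′ x₀ y₀ edge colours′ α 1≤α α≤Δ
                   (λ y e → α-absent-x₀ y (trans (sym (rows-without-α-kept x₀ α-absent-x₀ y)) e)) α-absent
  where
  open KempeSwap Δ α β α≢β 1≤α 1≤β α≤Δ β≤Δ
  open Swap (swap C proper y₀ β-absent-y₀) renaming (proper to proper′)
  colours′ : ColoursEdges (H ∖ x₀ , y₀) C′
  colours′ x y with T? (isαβ (C x y))
  ... | yes αβ = (λ _ → isαβ⇒nonzero (C′ x y) (αβ-kept x y αβ)) ,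
                 (λ ¬e → ⊥-elim (¬isαβ-0 (subst (T ∘ isαβ) (proj₂ (colours x y) ¬e) αβ)))
  ... | no ¬αβ = (λ e → subst (1 ≤_) (sym (others-kept x y ¬αβ)) (proj₁ (colours x y) e)) ,
                 (λ ¬e → trans (others-kept x y ¬αβ) (proj₂ (colours x y) ¬e))

konig-bounded : ∀ {m n Δ} N (H : Matrix Bool m n) → count₂ H ≤ N →
  (∀ x → count (row H x) ≤ Δ) → (∀ y → count (col H y) ≤ Δ) → EdgeColouring Δ H
konig-bounded N H bound row-deg col-deg with any? (λ x → any? (λ y → T? (H x y)))
... | no no-edge = (λ _ _ → 0) ,
                   record { bounded = λ _ _ → z≤n ; row-distinct = λ _ _ _ _ _ → refl ; col-distinct = λ _ _ _ _ _ → refl } ,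
                   (λ x y → (λ e → ⊥-elim (no-edge (x , y , e))) , (λ _ → refl))
... | yes (x₀ , y₀ , edge) with N
... | zero  = ⊥-elim (n≮0 (<-≤-trans (deleted-fewer-edges H x₀ y₀ edge) bound))
... | suc N = add-edge H x₀ y₀ edge
  (<-≤-trans (deleted-row-degree-x₀ H x₀ y₀ edge) (row-deg x₀))
  (<-≤-trans (deleted-col-degree-y₀ H x₀ y₀ edge) (col-deg y₀))
  (konig-bounded N (H ∖ x₀ , y₀) (≤-pred (<-≤-trans (deleted-fewer-edges H x₀ y₀ edge) bound))
    (λ x → ≤-trans (deleted-row-degree H x₀ y₀ x) (row-deg x))
    (λ y → ≤-trans (deleted-col-degree H x₀ y₀ y) (col-deg y)))

konig : ∀ {m n} Δ (H : Matrix Bool m n) →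
  (∀ x → count (row H x) ≤ Δ) → (∀ y → count (col H y) ≤ Δ) → EdgeColouring Δ H
konig Δ H = konig-bounded (count₂ H) H ≤-refl

degX≡count : ∀ {m n} (G : BipGraph m n) x → degX G x ≡ count (row G x)
degX≡count G x = length-filter≡count (row G x)

degY≡count : ∀ {m n} (G : BipGraph m n) y → degY G y ≡ count (col G y)
degY≡count G y = length-filter≡count (col G y)

degree≤colours : ∀ {m n t} (G : BipGraph m n) (φ : Colouring m n) → IsProperEdgeColouring G t φ →
  ∀ y → count (col G y) ≤ t
degree≤colours {t = t} G φ (in-range , _ , _ , col-distinct) y =
  DistinctColours.count≤Δ (col G y) (col φ y) t (λ x e → in-range x y e) (λ x x′ e e′ → col-distinct x x′ y e e′)

module _ {m n Δ : ℕ} (G : BipGraph m n) (C : Matrix ℕ m n)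
         (proper : IsPartialColouring Δ C) (colours : ColoursEdges G C) where

  open IsPartialColouring proper

  full-column-spectrum : ∀ y → count (col G y) ≡ Δ → ∀ c → SpecY G C y c ⇔ (1 ≤ c × c ≤ Δ)
  full-column-spectrum y deg≡Δ c = mk⇔
    (λ { (x , e , refl) → proj₁ (colours x y) e , bounded x y })
    (λ { (1≤c , c≤Δ) → ColColours.count≥Δ⇒all-occur G C proper colours y (≤-reflexive (sym deg≡Δ)) c 1≤c c≤Δ })

  edge-colouring-proper : ∀ y₀ → count (col G y₀) ≡ Δ → IsProperEdgeColouring G Δ C
  edge-colouring-proper y₀ deg≡Δ =
    (λ x y e → proj₁ (colours x y) e , bounded x y) ,
    (λ c 1≤c c≤Δ → let (x , e , C≡c) = Equivalence.from (full-column-spectrum y₀ deg≡Δ c) (1≤c , c≤Δ)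
                   in x , y₀ , e , C≡c) ,
    (λ x y y′ e _ y≢y′ same → m<n⇒n≢0 (proj₁ (colours x y) e) (row-distinct x y y′ y≢y′ same)) ,
    (λ x x′ y e _ x≢x′ same → m<n⇒n≢0 (proj₁ (colours x y) e) (col-distinct x x′ y x≢x′ same))

wY≡degree : ∀ {m n} k → 1 ≤ n → 1 ≤ k → (G : BipGraph m n) →
  (∀ x → degX G x ≤ k) → (∀ y → degY G y ≡ k) → wY≡ G k
wY≡degree {m} {suc n′} k _ 1≤k G degX≤k degY≡k = (C , proper , interval) , minimal
  where
  row-deg : ∀ x → count (row G x) ≤ k
  row-deg x = subst (_≤ k) (degX≡count G x) (degX≤k x)
  col-deg : ∀ y → count (col G y) ≡ k
  col-deg y = trans (sym (degY≡count G y)) (degY≡k y)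
  colouring : EdgeColouring k G
  colouring = konig k G row-deg (≤-reflexive ∘ col-deg)
  C : Matrix ℕ m (suc n′)
  C = proj₁ colouring
  proper : IsProperEdgeColouring G k C
  proper = edge-colouring-proper G C (proj₁ (proj₂ colouring)) (proj₂ (proj₂ colouring)) zero (col-deg zero)
  interval : IntervalOnY G C
  interval y = 1 , k , 1≤k , full-column-spectrum G C (proj₁ (proj₂ colouring)) (proj₂ (proj₂ colouring)) y (col-deg y)
  minimal : ∀ t → HasIntColY G t → k ≤ t
  minimal t (φ , φ-proper , _) = subst (_≤ t) (col-deg zero) (degree≤colours G φ φ-proper zero)

[g*l+r]/l≡g : ∀ g {r l} .{{_ : NonZero l}} → r < l → (g * l + r) / l ≡ g
[g*l+r]/l≡g g {r} {l} r<l = begin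
  (g * l + r) / l    ≡⟨ +-distrib-/-∣ˡ r (n∣m*n g) ⟩
  g * l / l + r / l  ≡⟨ cong₂ _+_ (m*n/n≡m g l) (m<n⇒m/n≡0 r<l) ⟩
  g + 0              ≡⟨ +-identityʳ g ⟩
  g                  ∎
  where open ≡-Reasoning

same-block : ∀ {l} .{{_ : NonZero l}} g g′ {c c′} → 1 ≤ c → c ≤ l → 1 ≤ c′ → c′ ≤ l →
  g * l + c ≡ g′ * l + c′ → g ≡ g′
same-block {l} g g′ {suc r} {suc r′} _ r<l _ r′<l e = begin
  g                 ≡⟨ [g*l+r]/l≡g g r<l ⟨
  (g * l + r) / l   ≡⟨ cong (_/ l) (suc-injectiveℕ (trans (sym (+-suc (g * l) r)) (trans e (+-suc (g′ * l) r′)))) ⟩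
  (g′ * l + r′) / l ≡⟨ [g*l+r]/l≡g g′ r′<l ⟩
  g′                ∎
  where open ≡-Reasoning

-- The ceiling ⌈ m / l ⌉ counts the blocks of l consecutive numbers below m:
-- the block a / l of any a < m is below it, and every block q below it
-- starts below m.
⌈suc/⌉ : ∀ a l .{{_ : NonZero l}} → ⌈ suc a / l ⌉ ≡ suc (a / l)
⌈suc/⌉ a l = begin
  (a + l) / l     ≡⟨ +-distrib-/-∣ʳ a (∣-refl {l}) ⟩
  a / l + l / l   ≡⟨ cong (a / l +_) (n/n≡1 l) ⟩
  a / l + 1       ≡⟨ +-comm (a / l) 1 ⟩
  suc (a / l)     ∎
  where open ≡-Reasoning

block-start<m : ∀ {m q l} .{{_ : NonZero l}} → q < ⌈ m / l ⌉ → q * l < m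
block-start<m {zero}  {q} {suc l} q<⌈0/l⌉ = ⊥-elim (n≮0 (subst (q <_) (m<n⇒m/n≡0 (n<1+n l)) q<⌈0/l⌉))
block-start<m {suc a} {q} {l} q<⌈m/l⌉ = s≤s (begin
  q * l        ≤⟨ *-monoˡ-≤ l (≤-pred (subst (q <_) (⌈suc/⌉ a l) q<⌈m/l⌉)) ⟩
  (a / l) * l  ≤⟨ m/n*n≤m a l ⟩
  a            ∎)
  where open ≤-Reasoning

block<⌈m/l⌉ : ∀ {m a l} .{{_ : NonZero l}} → a < m → a / l < ⌈ m / l ⌉
block<⌈m/l⌉ {suc b} {a} {l} (s≤s a≤b) = subst (a / l <_) (sym (⌈suc/⌉ b l)) (s≤s (/-monoˡ-≤ l a≤b))

-- Cut X into blocks of l consecutive vertices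
-- (x lies in block ⌊x/l⌋) and split every y ∈ Y into one copy (j , y) per
-- block j.  In the split graph G₂, x is joined to (block x , y) whenever
-- xy ∈ E(G): X-degrees stay l, and a copy (j , y) has at most l neighbours,
-- all in block j.  A König l-colouring of G₂, shifted by l · block x on the
-- edges at x, is then an interval colouring of G on X with l⌈m/l⌉ colours.
module BlockColouring {m n : ℕ} (l : ℕ) .{{_ : NonZero l}} (G : BipGraph m n)
                      (row-deg : ∀ x → count (row G x) ≡ l) where

  -- The block of x, also as an element of Fin m (there are at most m blocks).
  block : Fin m → ℕ
  block x = toℕ x / l

  block<m : ∀ x → block x < m
  block<m x = ≤-<-trans (m/n≤m (toℕ x) l) (toℕ<n x)

  blockᶠ : Fin m → Fin m
  blockᶠ x = fromℕ< (block<m x)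

  toℕ-blockᶠ : ∀ x → toℕ (blockᶠ x) ≡ block x
  toℕ-blockᶠ x = toℕ-fromℕ< (block<m x)

  split : Fin m → Fin m × Fin n → Bool
  split x (j , y) with j ≟F blockᶠ x
  ... | yes _ = G x y
  ... | no _  = false

  split-edge : ∀ x p → T (split x p) → T (G x (proj₂ p)) × proj₁ p ≡ blockᶠ x
  split-edge x (j , y) e with j ≟F blockᶠ x
  ... | yes j≡block = e , j≡block

  split-lift : ∀ x y → T (G x y) → T (split x (blockᶠ x , y))
  split-lift x y e with blockᶠ x ≟F blockᶠ x
  ... | yes _ = e
  ... | no ≢ = ⊥-elim (≢ refl)

  -- The copies Fin m × Fin n are encoded as Fin (m * n).
  copy : Fin (m * n) → Fin m × Fin n
  copy = remQuot n

  copy-combine : ∀ z → combine (proj₁ (copy z)) (proj₂ (copy z)) ≡ z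
  copy-combine = combine-remQuot {m} n

  G₂ : Matrix Bool m (m * n)
  G₂ x z = split x (copy z)

  G₂-lift : ∀ x y → T (G x y) → T (G₂ x (combine (blockᶠ x) y))
  G₂-lift x y e = subst (T ∘ split x) (sym (remQuot-combine (blockᶠ x) y)) (split-lift x y e)

  G₂-edge : ∀ x z → T (G₂ x z) → ∃ λ y → T (G x y) × z ≡ combine (blockᶠ x) y
  G₂-edge x z e = proj₂ (copy z) , proj₁ (split-edge x (copy z) e) ,
    trans (sym (copy-combine z)) (cong (λ j → combine j (proj₂ (copy z))) (proj₂ (split-edge x (copy z) e)))

  -- y ↦ (block x , y) matches the neighbours of x in G and in G₂.
  G₂-row-degree : ∀ x → count (row G₂ x) ≡ l
  G₂-row-degree x = ≤-antisym
    (subst (count (row G₂ x) ≤_) (row-deg x)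
      (count-injection (row G₂ x) (row G x) (proj₂ ∘ copy) (λ z e → proj₁ (split-edge x (copy z) e))
        (λ z z′ e e′ same → trans (proj₂ (proj₂ (G₂-edge x z e)))
                             (trans (cong (combine (blockᶠ x)) same) (sym (proj₂ (proj₂ (G₂-edge x z′ e′))))))))
    (subst (_≤ count (row G₂ x)) (row-deg x)
      (count-injection (row G x) (row G₂ x) (combine (blockᶠ x)) (G₂-lift x)
        (λ y y′ _ _ same → proj₂ (combine-injective (blockᶠ x) y (blockᶠ x) y′ same))))

  remainder-injective : ∀ x x′ → block x ≡ block x′ → toℕ x mod l ≡ toℕ x′ mod l → x ≡ x′
  remainder-injective x x′ same-block same-rem = toℕ-injective (begin
    toℕ x                          ≡⟨ m≡m%n+[m/n]*n (toℕ x) l ⟩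
    toℕ x % l + block x * l        ≡⟨ cong₂ (λ r g → r + g * l) same-%  same-block ⟩
    toℕ x′ % l + block x′ * l      ≡⟨ m≡m%n+[m/n]*n (toℕ x′) l ⟨
    toℕ x′                         ∎)
    where
    open ≡-Reasoning
    same-% : toℕ x % l ≡ toℕ x′ % l
    same-% = trans (sym (toℕ-fromℕ< _)) (trans (cong toℕ same-rem) (toℕ-fromℕ< _))

  -- The neighbours of a copy (j , y) all lie in block j, so x ↦ x mod l is
  -- injective on them.
  G₂-col-degree : ∀ z → count (col G₂ z) ≤ l
  G₂-col-degree z = subst (count (col G₂ z) ≤_) (count-all l)
    (count-injection (col G₂ z) (λ _ → true) (λ x → toℕ x mod l) (λ _ _ → _)
      (λ x x′ e e′ → remainder-injective x x′ (same-block-at e e′)))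
    where
    same-block-at : ∀ {x x′} → T (G₂ x z) → T (G₂ x′ z) → block x ≡ block x′
    same-block-at {x} {x′} e e′ =
      trans (sym (toℕ-blockᶠ x)) (trans (cong toℕ (trans (sym (proj₂ (split-edge x (copy z) e)))
                                                         (proj₂ (split-edge x′ (copy z) e′))))
                                        (toℕ-blockᶠ x′))

  C₂-colouring : EdgeColouring l G₂
  C₂-colouring = konig l G₂ (≤-reflexive ∘ G₂-row-degree) G₂-col-degree

  C₂ : Matrix ℕ m (m * n)
  C₂ = proj₁ C₂-colouring

  C₂-proper : IsPartialColouring l C₂
  C₂-proper = proj₁ (proj₂ C₂-colouring)

  C₂-colours : ColoursEdges G₂ C₂
  C₂-colours = proj₂ (proj₂ C₂-colouring)

  open IsPartialColouring C₂-proper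

  offset : Fin m → Fin n → ℕ
  offset x y = C₂ x (combine (blockᶠ x) y)

  offset-range : ∀ x y → T (G x y) → 1 ≤ offset x y × offset x y ≤ l
  offset-range x y e = proj₁ (C₂-colours x _) (G₂-lift x y e) , bounded x _

  -- Every offset in [1,l] occurs at x, which has degree l in G₂.
  offset-occurs : ∀ x r → 1 ≤ r → r ≤ l → ∃ λ y → T (G x y) × offset x y ≡ r
  offset-occurs x r 1≤r r≤l
    with RowColours.count≥Δ⇒all-occur G₂ C₂ C₂-proper C₂-colours x (≤-reflexive (sym (G₂-row-degree x))) r 1≤r r≤l
  ... | z , e , C₂≡r with G₂-edge x z e
  ... | y , e′ , refl = y , e′ , C₂≡r

  φ : Colouring m n
  φ x y = block x * l + offset x y

  colour-bound : ∀ g c → g < ⌈ m / l ⌉ → c ≤ l → g * l + c ≤ l * ⌈ m / l ⌉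
  colour-bound g c g<⌈m/l⌉ c≤l = begin
    g * l + c      ≤⟨ +-monoʳ-≤ (g * l) c≤l ⟩
    g * l + l      ≡⟨ +-comm (g * l) l ⟩
    suc g * l      ≤⟨ *-monoˡ-≤ l g<⌈m/l⌉ ⟩
    ⌈ m / l ⌉ * l  ≡⟨ *-comm ⌈ m / l ⌉ l ⟩
    l * ⌈ m / l ⌉  ∎
    where open ≤-Reasoning

  -- Colour suc a is used at the first vertex of block a / l, with offset
  -- 1 + a % l.
  colour-used : ∀ c → 1 ≤ c → c ≤ l * ⌈ m / l ⌉ → ∃ λ x → ∃ λ y → T (G x y) × φ x y ≡ c
  colour-used (suc a) _ c≤t = x , y , e , φ≡c
    where
    q<⌈m/l⌉ : a / l < ⌈ m / l ⌉
    q<⌈m/l⌉ = m<n*o⇒m/o<n (subst (a <_) (*-comm l ⌈ m / l ⌉) c≤t)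
    x : Fin m
    x = fromℕ< (block-start<m q<⌈m/l⌉)
    block-x : block x ≡ a / l
    block-x = trans (cong (_/ l) (toℕ-fromℕ< (block-start<m q<⌈m/l⌉))) (m*n/n≡m (a / l) l)
    found : ∃ λ y → T (G x y) × offset x y ≡ suc (a % l)
    found = offset-occurs x (suc (a % l)) (s≤s z≤n) (m%n<n a l)
    y : Fin n
    y = proj₁ found
    e : T (G x y)
    e = proj₁ (proj₂ found)
    φ≡c : φ x y ≡ suc a
    φ≡c = begin
      block x * l + offset x y   ≡⟨ cong₂ (λ g c → g * l + c) block-x (proj₂ (proj₂ found)) ⟩
      a / l * l + suc (a % l)    ≡⟨ +-suc (a / l * l) (a % l) ⟩
      suc (a / l * l + a % l)    ≡⟨ cong suc (+-comm (a / l * l) (a % l)) ⟩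
      suc (a % l + a / l * l)    ≡⟨ cong suc (m≡m%n+[m/n]*n a l) ⟨
      suc a                      ∎
      where open ≡-Reasoning

  -- Two edges at y from different blocks get colours in different blocks;
  -- from the same block they are two edges of G₂ at the same copy.
  φ-proper : IsProperEdgeColouring G (l * ⌈ m / l ⌉) φ
  φ-proper = in-range , colour-used , row-distinct′ , col-distinct′
    where
    in-range : ∀ x y → T (G x y) → 1 ≤ φ x y × φ x y ≤ l * ⌈ m / l ⌉
    in-range x y e = ≤-trans (proj₁ (offset-range x y e)) (m≤n+m _ (block x * l)) ,
                     colour-bound (block x) _ (block<⌈m/l⌉ (toℕ<n x)) (proj₂ (offset-range x y e))
    row-distinct′ : ∀ x y y′ → T (G x y) → T (G x y′) → y ≢ y′ → φ x y ≢ φ x y′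
    row-distinct′ x y y′ e _ y≢y′ same = m<n⇒n≢0 (proj₁ (offset-range x y e))
      (row-distinct x _ _ (y≢y′ ∘ proj₂ ∘ combine-injective (blockᶠ x) y (blockᶠ x) y′)
                          (+-cancelˡ-≡ (block x * l) _ _ same))
    col-distinct′ : ∀ x x′ y → T (G x y) → T (G x′ y) → x ≢ x′ → φ x y ≢ φ x′ y
    col-distinct′ x x′ y e e′ x≢x′ same = m<n⇒n≢0 (proj₁ (offset-range x y e))
      (col-distinct x x′ _ x≢x′ (trans (+-cancelˡ-≡ (block x * l) _ _ (trans same (cong (λ g → g * l + offset x′ y) (sym same-g))))
                                       (cong (λ j → C₂ x′ (combine j y)) (sym same-blockᶠ))))
      where
      same-g : block x ≡ block x′
      same-g = same-block (block x) (block x′) (proj₁ (offset-range x y e)) (proj₂ (offset-range x y e))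
                 (proj₁ (offset-range x′ y e′)) (proj₂ (offset-range x′ y e′)) same
      same-blockᶠ : blockᶠ x ≡ blockᶠ x′
      same-blockᶠ = toℕ-injective (trans (toℕ-blockᶠ x) (trans same-g (sym (toℕ-blockᶠ x′))))

  φ-interval : IntervalOnX G φ
  φ-interval x = s + 1 , s + l , +-monoʳ-≤ s (>-nonZero⁻¹ l) , λ c → mk⇔
    (λ { (y , e , refl) → +-monoʳ-≤ s (proj₁ (offset-range x y e)) , +-monoʳ-≤ s (proj₂ (offset-range x y e)) })
    (λ { (s+1≤c , c≤s+l) → from c s+1≤c c≤s+l })
    where
    s : ℕ
    s = block x * l
    from : ∀ c → s + 1 ≤ c → c ≤ s + l → ∃ λ y → T (G x y) × φ x y ≡ c
    from c s+1≤c c≤s+l =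
      let (y , e , offset≡c∸s) = offset-occurs x (c ∸ s)
                                   (subst (_≤ c ∸ s) (m+n∸m≡n s 1) (∸-monoˡ-≤ s s+1≤c))
                                   (subst (c ∸ s ≤_) (m+n∸m≡n s l) (∸-monoˡ-≤ s c≤s+l))
      in y , e , trans (cong (s +_) offset≡c∸s) (m+[n∸m]≡n (≤-trans (m≤m+n s 1) s+1≤c))

wX≤block-bound : ∀ {m n} l .{{_ : NonZero l}} (G : BipGraph m n) → (∀ x → degX G x ≡ l) → wX≤ G (l * ⌈ m / l ⌉)
wX≤block-bound {m} l G degX≡l = l * ⌈ m / l ⌉ , ≤-refl , φ , φ-proper , φ-interval
  where open BlockColouring l G (λ x → trans (sym (degX≡count G x)) (degX≡l x))

-- Counting edges from both sides, m · l = n · k; with m ≥ n ≥ 1 this forces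
-- the X-degree l to be at most the Y-degree k.
degree-comparison : ∀ m l n k → 1 ≤ n → m ≥ n → m * l ≡ n * k → l ≤ k
degree-comparison m l (suc n′) k _ n≤m ml≡nk = *-cancelˡ-≤ (suc n′) (begin
  suc n′ * l  ≤⟨ *-monoˡ-≤ l n≤m ⟩
  m * l       ≡⟨ ml≡nk ⟩
  suc n′ * k  ∎)
  where open ≤-Reasoning

theorem3 : (m l n k : ℕ) → 1 ≤ m → .{{_ : NonZero l}} → 1 ≤ n → 1 ≤ k →
    m ≥ n → m * l ≡ n * k →
    (G : BipGraph m n) → InBip m l n k G →
    wY≡ G k × wX≤ G (l * ⌈ m / l ⌉)
theorem3 m l n k _ 1≤n 1≤k n≤m ml≡nk G (degX≡l , degY≡k) =
  wY≡degree k 1≤n 1≤k G degX≤k degY≡k , wX≤block-bound l G degX≡l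
  where
  degX≤k : ∀ x → degX G x ≤ k
  degX≤k x = subst (_≤ k) (sym (degX≡l x)) (degree-comparison m l n k 1≤n n≤m ml≡nk)
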